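{- Let $V$ be a finite set of $n\ge 1$ vertices with a metric $d$ (i.e. $d_{ij}\ge 0$, $d_{ii}=0$, $d_{ij}=d_{ji}$, $d_{hi}+d_{ij}\ge d_{hj}$ for all $h,i,j\in V$), and let $k\ge 1$, $q\ge 0$ be integers. Run the following procedure (Algorithm 1): start with $P:=V$, $S:=\emptyset$; while $P\neq\emptyset$, choose $s\in P$ with $s\in\arg\min_{i\in P} NR(i)$ (ties broken arbitrarily), set $S:=S\cup\{s\}$ and $P:=\{i\in P: d_{is}>2\,NR(i)\}$. Finally set $O:=\emptyset$ and, for each $i\in V$, let $\sigma(i)\in\arg\min_{h\in S} d_{ih}$. Then the output $(S,O,\sigma)$ is a feasible solution of the IF$k$CO instance $(V,d,k,q)$, i.e. $|S|\le k$ and $|O|\le q$.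
   Context: For $i\in V$, $NR(i)$ (the neighborhood radius) is the distance from $i$ to its $\lceil n/k\rceil$-th nearest neighbour in $V$, where vertices are ordered by nondecreasing distance from $i$ and $i$ itself counts as its own (first) nearest neighbour. In the individually fair $k$-center with outliers (IF$k$CO) on instance $(V,d,k,q)$, a solution is a triple $(S,O,\sigma)$ with $S\subseteq V$ (centers), $O\subseteq V$ (outliers) and $\sigma:V\setminus O\to S$ an assignment; it is feasible if $|S|\le k$ and $|O|\le q$.
   Formalization: The distances $d_{ij}$ of the metric take rational values. -}

module Defs where

open import Data.Nat as ℕ using (ℕ; zero; suc; NonZero)
open import Data.Nat.DivMod using (_/_)
open import Data.Fin using (Fin)
open import Data.Bool using (Bool; true; false; _∧_)
open import Data.List using (List; []; _∷_; map; length)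
open import Data.List.Membership.Propositional using (_∈_)
open import Data.Fin.Base using ()
open import Data.List using (allFin)
open import Data.Rational using (ℚ; 0ℚ; _+_; _≤_; _<_)
open import Data.Rational.Properties using (≤-decTotalOrder; _<?_)
open import Data.List.Sort ≤-decTotalOrder using (sort)
open import Data.Product using (_×_)
open import Relation.Binary.PropositionalEquality using (_≡_)
open import Relation.Nullary.Decidable using (⌊_⌋)

record IsMetric {n : ℕ} (d : Fin n → Fin n → ℚ) : Set where
  field
    nonneg : ∀ i j → 0ℚ ≤ d i j
    refl0  : ∀ i → d i i ≡ 0ℚ
    symm   : ∀ i j → d i j ≡ d j i
    triang : ∀ h i j → d h j ≤ d h i + d i j

⌈_/_⌉ : ℕ → (k : ℕ) → {{NonZero k}} → ℕ
⌈ n / k ⌉ = (n ℕ.+ (k ℕ.∸ 1)) / k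

-- m-th element (0-based) of a list; default 0ℚ if out of range
-- (never out of range in our uses, since 1 ≤ ⌈n/k⌉ ≤ n).
nth : List ℚ → ℕ → ℚ
nth []       _       = 0ℚ
nth (x ∷ xs) zero    = x
nth (x ∷ xs) (suc m) = nth xs m

-- NR(i): the ⌈n/k⌉-th smallest value (1-based) among d(i,j), j ∈ V
-- (the list includes j = i, distance 0, so i is its own first neighbour).
NR : {n : ℕ} → (d : Fin n → Fin n → ℚ) → (k : ℕ) → {{NonZero k}} → Fin n → ℚ
NR {n} d k i = nth (sort (map (d i) (allFin n))) (⌈ n / k ⌉ ℕ.∸ 1)

nextP : {n : ℕ} → (d : Fin n → Fin n → ℚ) → (k : ℕ) → {{NonZero k}} →
        (Fin n → Bool) → Fin n → (Fin n → Bool)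
nextP d k P s i = P i ∧ ⌊ (NR d k i + NR d k i) <? d i s ⌋

-- Alg1 d k P S : running the while-loop of Algorithm 1 from the current set P
-- (with arbitrary tie-breaking) can add exactly the centers S (in selection order).
data Alg1 {n : ℕ} (d : Fin n → Fin n → ℚ) (k : ℕ) {{_ : NonZero k}} :
          (Fin n → Bool) → List (Fin n) → Set where
  done : ∀ {P} → (∀ i → P i ≡ false) → Alg1 d k P []
  step : ∀ {P S} (s : Fin n) →
         P s ≡ true →
         (∀ i → P i ≡ true → NR d k s ≤ NR d k i) →
         Alg1 d k (nextP d k P s) S →
         Alg1 d k P (s ∷ S)

IsNearestAssignment : {n : ℕ} → (Fin n → Fin n → ℚ) → List (Fin n) → (Fin n → Fin n) → Set
IsNearestAssignment d S σ = ∀ i → (σ i ∈ S) × (∀ h → h ∈ S → d i (σ i) ≤ d i h)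

-- Solution (S, O, σ) of IFkCO (S, O as duplicate-free lists of vertices)
-- is feasible iff |S| ≤ k and |O| ≤ q.
Feasible : {n : ℕ} → (k q : ℕ) → (S O : List (Fin n)) → (σ : Fin n → Fin n) → Set
Feasible k q S O σ = (length S ℕ.≤ k) × (length O ℕ.≤ q)

{-# OPTIONS --safe #-}
-- Every centre s chosen by Algorithm 1 owns the ball B(s) = {j : d(s,j) ≤ NR(s)}, which has at
-- least ⌈n/k⌉ points because NR(s) is the ⌈n/k⌉-th smallest distance from s. The balls of two
-- centres s (chosen first) and p (chosen later) are disjoint: p survived the update, so
-- d(p,s) > 2 NR(p), while NR(s) ≤ NR(p) by the choice of s, and the triangle inequality
-- separates the balls. Hence |S| ⌈n/k⌉ ≤ n, which forces |S| ≤ k; and O is empty.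
-- For the induction along the run, the balls of the centres still to be chosen from the
-- candidate set P are counted inside the union of the balls of all members of P.
module Submission where

open import Defs
open import Data.Nat using (ℕ; NonZero; _≤_; zero; suc; s≤s; z≤n; _+_; _∸_; _<_; _*_; >-nonZero; >-nonZero⁻¹)
import Data.Nat.Properties as ℕₚ
open import Data.Nat.DivMod using (_%_; m≡m%n+[m/n]*n; m%n<n; m*n/n≡m; /-monoˡ-≤; m≥n⇒m/n>0; m<n⇒m/n≡0)
open import Data.Fin using (Fin)
open import Data.Fin.Properties using (any?; nonZeroIndex)
open import Data.Bool using (Bool; true; false)
import Data.Bool.Properties as Bool
open import Data.List using (List; []; _∷_; map; filter; length; allFin)
open import Data.List.Properties using (length-filter; length-map; length-tabulate; filter-accept)
open import Data.Rational as ℚ using (ℚ)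
import Data.Rational.Properties as ℚₚ
open ℚₚ using (_≤?_)
open import Data.List.Sort ℚₚ.≤-decTotalOrder using (sort; sort-↭; sort-↗)
open import Data.List.Relation.Unary.Linked using (Linked; _∷_; tail)
open import Data.List.Relation.Binary.Permutation.Propositional.Properties using (↭-length; filter-↭)
open import Data.Product using (_×_; _,_; proj₁; ∃-syntax)
open import Data.Empty using (⊥-elim)
open import Function using (_∘_; id)
open import Level using (0ℓ)
open import Relation.Nullary using (¬_; yes; no; does; contradiction)
open import Relation.Nullary.Decidable using (_×-dec_)
open import Relation.Unary using (Pred; Decidable; _⊆_; _⊥_)
open import Relation.Binary.PropositionalEquality using (_≡_; refl; sym; trans; cong; subst; subst₂)

⌈n/k⌉≤n : ∀ n k {{_ : NonZero k}} → ⌈ n / k ⌉ ≤ n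
⌈n/k⌉≤n zero    (suc k′) = ℕₚ.≤-reflexive (m<n⇒m/n≡0 (ℕₚ.n<1+n k′))
⌈n/k⌉≤n n@(suc _) k@(suc k′) = subst (⌈ n / k ⌉ ≤_) (m*n/n≡m n k) (/-monoˡ-≤ k n+k′≤n*k)
  where
  n+k′≤n*k : n + k′ ≤ n * k
  n+k′≤n*k = subst (n + k′ ≤_) (sym (ℕₚ.*-suc n k′)) (ℕₚ.+-monoʳ-≤ n (ℕₚ.m≤n*m k′ n))

⌈n/k⌉>0 : ∀ {n} k {{_ : NonZero k}} → 1 ≤ n → 0 < ⌈ n / k ⌉
⌈n/k⌉>0 (suc k′) 1≤n = m≥n⇒m/n>0 (ℕₚ.+-monoˡ-≤ k′ 1≤n)

n≤⌈n/k⌉*k : ∀ n k {{_ : NonZero k}} → n ≤ ⌈ n / k ⌉ * k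
n≤⌈n/k⌉*k n k@(suc k′) = ℕₚ.+-cancelʳ-≤ k′ n (⌈ n / k ⌉ * k) (begin
  n + k′                            ≡⟨ m≡m%n+[m/n]*n (n + k′) k ⟩
  (n + k′) % k + ⌈ n / k ⌉ * k      ≤⟨ ℕₚ.+-monoˡ-≤ _ (ℕₚ.≤-pred (m%n<n (n + k′) k)) ⟩
  k′ + ⌈ n / k ⌉ * k                ≡⟨ ℕₚ.+-comm k′ _ ⟩
  ⌈ n / k ⌉ * k + k′                ∎)
  where open ℕₚ.≤-Reasoning

*⌈n/k⌉≤n⇒≤k : ∀ {m n} k {{_ : NonZero k}} → 1 ≤ n → m * ⌈ n / k ⌉ ≤ n → m ≤ k
*⌈n/k⌉≤n⇒≤k {m} {n} k 1≤n m*⌈n/k⌉≤n = ℕₚ.≮⇒≥ λ k<m → ℕₚ.<-irrefl refl (begin-strict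
  n                    ≤⟨ n≤⌈n/k⌉*k n k ⟩
  ⌈ n / k ⌉ * k        ≡⟨ ℕₚ.*-comm ⌈ n / k ⌉ k ⟩
  k * ⌈ n / k ⌉        <⟨ ℕₚ.+-monoˡ-< _ (⌈n/k⌉>0 k 1≤n) ⟩
  suc k * ⌈ n / k ⌉    ≤⟨ ℕₚ.*-monoˡ-≤ ⌈ n / k ⌉ k<m ⟩
  m * ⌈ n / k ⌉        ≤⟨ m*⌈n/k⌉≤n ⟩
  n                    ∎)
  where open ℕₚ.≤-Reasoning

module _ {a b p} {A : Set a} {B : Set b} {P : Pred B p} (P? : Decidable P) (f : A → B) where

  length-filter-map : ∀ xs → length (filter P? (map f xs)) ≡ length (filter (P? ∘ f) xs)
  length-filter-map []       = refl
  length-filter-map (x ∷ xs) with does (P? (f x))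
  ... | true  = cong suc (length-filter-map xs)
  ... | false = length-filter-map xs

module _ {a p} {A : Set a} {P Q R : Pred A p}
         (P? : Decidable P) (Q? : Decidable Q) (R? : Decidable R) where

  length-filter-⊥ : P ⊥ Q → P ⊆ R → Q ⊆ R → ∀ xs →
    length (filter P? xs) + length (filter Q? xs) ≤ length (filter R? xs)
  length-filter-⊥ P⊥Q P⊆R Q⊆R [] = z≤n
  length-filter-⊥ P⊥Q P⊆R Q⊆R (x ∷ xs)
    with P? x | Q? x | R? x | length-filter-⊥ P⊥Q P⊆R Q⊆R xs
  ... | yes px | yes qx | _      | _  = ⊥-elim (P⊥Q (px , qx))
  ... | yes px | no _   | no ¬rx | _  = contradiction (P⊆R px) ¬rx
  ... | no _   | yes qx | no ¬rx | _  = contradiction (Q⊆R qx) ¬rx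
  ... | yes _  | no _   | yes _  | ih = s≤s ih
  ... | no _   | yes _  | yes _  | ih =
    subst (_≤ suc (length (filter R? xs)))
          (sym (ℕₚ.+-suc (length (filter P? xs)) (length (filter Q? xs)))) (s≤s ih)
  ... | no _   | no _   | yes _  | ih = ℕₚ.m≤n⇒m≤1+n ih
  ... | no _   | no _   | no _   | ih = ih

head≤nth : ∀ {x xs m} → Linked ℚ._≤_ (x ∷ xs) → m < length xs → x ℚ.≤ nth xs m
head≤nth {m = zero}  (x≤y ∷ _)      _         = x≤y
head≤nth {m = suc m} (x≤y ∷ sorted) (s≤s m<) = ℚₚ.≤-trans x≤y (head≤nth sorted m<)

length-filter-≤nth : ∀ {xs} m → Linked ℚ._≤_ xs → m < length xs →
  suc m ≤ length (filter (_≤? nth xs m) xs)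
length-filter-≤nth {x ∷ xs} zero    _      _
  rewrite filter-accept (_≤? x) {xs = xs} (ℚₚ.≤-refl {x}) = s≤s z≤n
length-filter-≤nth {x ∷ xs} (suc m) sorted (s≤s m<)
  rewrite filter-accept (_≤? nth xs m) {xs = xs} (head≤nth sorted m<) =
    s≤s (length-filter-≤nth m (tail sorted) m<)

module _ {n} {d : Fin n → Fin n → ℚ} (metric : IsMetric d) where
  open IsMetric metric

  far-balls-disjoint : ∀ {p s j r t} → t ℚ.≤ r → r ℚ.+ r ℚ.< d p s →
    ¬ (d p j ℚ.≤ r × d s j ℚ.≤ t)
  far-balls-disjoint {p} {s} {j} {r} t≤r r+r<dps (dpj≤r , dsj≤t) =
    ℚₚ.<-irrefl refl (ℚₚ.<-≤-trans r+r<dps (begin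
      d p s            ≤⟨ triang p j s ⟩
      d p j ℚ.+ d j s  ≡⟨ cong (d p j ℚ.+_) (symm j s) ⟩
      d p j ℚ.+ d s j  ≤⟨ ℚₚ.+-mono-≤ dpj≤r (ℚₚ.≤-trans dsj≤t t≤r) ⟩
      r ℚ.+ r          ∎))
    where open ℚₚ.≤-Reasoning

∣_∣ : ∀ {n} {P : Pred (Fin n) 0ℓ} → Decidable P → ℕ
∣_∣ {n} P? = length (filter P? (allFin n))

∣P∣≤n : ∀ {n} {P : Pred (Fin n) 0ℓ} (P? : Decidable P) → ∣ P? ∣ ≤ n
∣P∣≤n {n} P? = ℕₚ.≤-trans (length-filter P? (allFin n)) (ℕₚ.≤-reflexive (length-tabulate id))

module _ {n} (d : Fin n → Fin n → ℚ) (k : ℕ) {{_ : NonZero k}} where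

  Ball : Fin n → Pred (Fin n) 0ℓ
  Ball s j = d s j ℚ.≤ NR d k s

  ball? : ∀ s → Decidable (Ball s)
  ball? s j = d s j ≤? NR d k s

  Reach : (Fin n → Bool) → Pred (Fin n) 0ℓ
  Reach P j = ∃[ p ] P p ≡ true × Ball p j

  reach? : ∀ P → Decidable (Reach P)
  reach? P j = any? λ p → (P p Bool.≟ true) ×-dec ball? p j

  ⌈n/k⌉≤∣ball∣ : ∀ s → ⌈ n / k ⌉ ≤ ∣ ball? s ∣
  ⌈n/k⌉≤∣ball∣ s = begin
    ⌈ n / k ⌉                          ≡⟨ sym (ℕₚ.suc-pred ⌈ n / k ⌉ {{>-nonZero c>0}}) ⟩
    suc m                              ≤⟨ length-filter-≤nth m (sort-↗ L) m<length-sort-L ⟩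
    length (filter (_≤? r) (sort L))   ≡⟨ ↭-length (filter-↭ (_≤? r) (sort-↭ L)) ⟩
    length (filter (_≤? r) L)          ≡⟨ length-filter-map (_≤? r) (d s) (allFin n) ⟩
    ∣ ball? s ∣                        ∎
    where
    open ℕₚ.≤-Reasoning
    L : List ℚ
    L = map (d s) (allFin n)
    m : ℕ
    m = ⌈ n / k ⌉ ∸ 1
    r : ℚ
    r = NR d k s
    c>0 : 0 < ⌈ n / k ⌉
    c>0 = ⌈n/k⌉>0 k (>-nonZero⁻¹ n {{nonZeroIndex s}})
    length-sort-L≡n : length (sort L) ≡ n
    length-sort-L≡n =
      trans (↭-length (sort-↭ L)) (trans (length-map (d s) (allFin n)) (length-tabulate id))
    m<length-sort-L : m < length (sort L)
    m<length-sort-L = subst₂ _≤_ (sym (ℕₚ.suc-pred ⌈ n / k ⌉ {{>-nonZero c>0}}))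
                                 (sym length-sort-L≡n) (⌈n/k⌉≤n n k)

  nextP⁻ : ∀ P s {p} → nextP d k P s p ≡ true →
    P p ≡ true × NR d k p ℚ.+ NR d k p ℚ.< d p s
  nextP⁻ P s {p} eq with P p | NR d k p ℚ.+ NR d k p ℚₚ.<? d p s
  nextP⁻ P s refl | true | yes far = refl , far

module _ {n} {d : Fin n → Fin n → ℚ} (metric : IsMetric d) (k : ℕ) {{_ : NonZero k}} where

  length*⌈n/k⌉≤∣reach∣ : ∀ {P S} → Alg1 d k P S → length S * ⌈ n / k ⌉ ≤ ∣ reach? d k P ∣
  length*⌈n/k⌉≤∣reach∣ (done _) = z≤n
  length*⌈n/k⌉≤∣reach∣ {P} {s ∷ S} (step s Ps s-minimal run) = begin
    ⌈ n / k ⌉ + length S * ⌈ n / k ⌉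
      ≤⟨ ℕₚ.+-mono-≤ (⌈n/k⌉≤∣ball∣ d k s) (length*⌈n/k⌉≤∣reach∣ run) ⟩
    ∣ ball? d k s ∣ + ∣ reach? d k P′ ∣
      ≤⟨ length-filter-⊥ (ball? d k s) (reach? d k P′) (reach? d k P)
                         disjoint (λ b → s , Ps , b) shrinks (allFin n) ⟩
    ∣ reach? d k P ∣
      ∎
    where
    open ℕₚ.≤-Reasoning
    P′ : Fin n → Bool
    P′ = nextP d k P s
    disjoint : Ball d k s ⊥ Reach d k P′
    disjoint (bs , p , P′p , bp) with nextP⁻ d k P s P′p
    ... | Pp , far = far-balls-disjoint metric (s-minimal p Pp) far (bp , bs)
    shrinks : Reach d k P′ ⊆ Reach d k P
    shrinks (p , P′p , bp) = p , proj₁ (nextP⁻ d k P s P′p) , bp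

lemma1 : (n : ℕ) → 1 ≤ n → (d : Fin n → Fin n → ℚ) → IsMetric d →
         (k : ℕ) → {{_ : NonZero k}} → (q : ℕ) →
         (S : List (Fin n)) → Alg1 d k (λ _ → true) S →
         (σ : Fin n → Fin n) → IsNearestAssignment d S σ →
         Feasible k q S [] σ
lemma1 n 1≤n d metric k q S run σ _ = |S|≤k , z≤n
  where
  |S|≤k : length S ≤ k
  |S|≤k = *⌈n/k⌉≤n⇒≤k k 1≤n
    (ℕₚ.≤-trans (length*⌈n/k⌉≤∣reach∣ metric k run) (∣P∣≤n (reach? d k (λ _ → true))))
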